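{- Let $N=\{1,\ldots,n\}$ and let $v$ be a bi-cooperative game on $N$ with M\"obius transform $m$. For every $i\in N$, \[ \phi^v_{i,\emptyset}=\sum_{(S,T)\in\mathcal{Q}(N),\ (S,T)\sqsupseteq(\{i\},N\setminus\{i\})}\frac{1}{n-|T|}\,m(S,T),\qquad \phi^v_{\emptyset,i}=\sum_{(S,T)\in\mathcal{Q}(N\setminus\{i\}),\ (S,T)\sqsupseteq(\emptyset,N\setminus\{i\})}\frac{1}{n-|T|}\,m(S,T). \]
   Context: $\mathcal{Q}(N)=\{(A,B)\in 2^N\times 2^N : A\cap B=\emptyset\}$ (similarly $\mathcal{Q}(M)$ for $M\subseteq N$), ordered by $(A,B)\sqsubseteq(C,D)$ iff $A\subseteq C$ and $B\supseteq D$. A bi-cooperative game is any $v:\mathcal{Q}(N)\to\mathbb{R}$ with $v(\emptyset,\emptyset)=0$. Its M\"obius transform is the unique $m:\mathcal{Q}(N)\to\mathbb{R}$ with $v(A,A')=\sum_{(B,B')\sqsubseteq(A,A')}m(B,B')$. The Shapley value of $v$ is defined by $\phi^v_{i,\emptyset}=\sum_{S\subseteq N\setminus\{i\}}\frac{(n-s-1)!s!}{n!}\big[v(S\cup\{i\},N\setminus(S\cup\{i\}))-v(S,N\setminus(S\cup\{i\}))\big]$ and $\phi^v_{\emptyset,i}=\sum_{S\subseteq N\setminus\{i\}}\frac{(n-s-1)!s!}{n!}\big[v(S,N\setminus(S\cup\{i\}))-v(S,N\setminus S)\big]$, where $s=|S|$.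
   Formalization: The bi-cooperative game v and its Möbius transform m take values in ℚ rather than ℝ. -}

module Defs where

open import Data.Nat using (ℕ; zero; suc; _∸_; _!)
open import Data.Integer using (+_)
open import Data.Bool using (Bool; true; false; if_then_else_)
open import Data.Vec using ([]; _∷_)
open import Data.List using (List; []; _∷_; _++_; map; foldr)
open import Data.Product using (_×_)
open import Data.Fin using (Fin)
open import Data.Fin.Subset using (Subset; inside; outside; _∩_; _∪_; ∁; ⁅_⁆; _⊆_; _∈_; _∉_; Empty; ∣_∣; ⊥)
open import Data.Fin.Subset.Properties using (_⊆?_; nonempty?; _∈?_)
open import Data.Rational using (ℚ; 0ℚ; 1ℚ; _+_; _*_; _-_; 1/_)
import Data.Rational as Q
open import Relation.Binary.PropositionalEquality using (_≡_)
open import Relation.Nullary using (Dec; ¬_; ¬?)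
open import Relation.Nullary.Decidable using (⌊_⌋; _×-dec_)

sumℚ : List ℚ → ℚ
sumℚ = foldr _+_ 0ℚ

allSubsets : (n : ℕ) → List (Subset n)
allSubsets zero    = [] ∷ []
allSubsets (suc n) = map (outside ∷_) (allSubsets n) ++ map (inside ∷_) (allSubsets n)

ΣSub : {n : ℕ} → (Subset n → ℚ) → ℚ
ΣSub {n} f = sumℚ (map f (allSubsets n))

[_]⇒_ : {P : Set} → Dec P → ℚ → ℚ
[ d ]⇒ q = if ⌊ d ⌋ then q else 0ℚ

ℕ→ℚ : ℕ → ℚ
ℕ→ℚ k = (+ k) Q./ 1

-- Reciprocal of a natural number (only ever applied to nonzero numbers below;
-- the value 0 at 0 is an irrelevant convention).
recip : ℕ → ℚ
recip zero    = 0ℚ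
recip (suc k) = (+ 1) Q./ (suc k)

Disjoint : {n : ℕ} → Subset n → Subset n → Set
Disjoint A B = Empty (A ∩ B)

disjoint? : {n : ℕ} (A B : Subset n) → Dec (Disjoint A B)
disjoint? A B = ¬? (nonempty? (A ∩ B))

_⊑_ : {n : ℕ} → Subset n × Subset n → Subset n × Subset n → Set
(A Data.Product., B) ⊑ (C Data.Product., D) = A ⊆ C × D ⊆ B

_⊑?_ : {n : ℕ} (p q : Subset n × Subset n) → Dec (p ⊑ q)
(A Data.Product., B) ⊑? (C Data.Product., D) = (A ⊆? C) ×-dec (D ⊆? B)

-- A bi-cooperative game is represented by v : Subset n → Subset n → ℚ (only its
-- values on disjoint pairs, i.e. on Q(N), are ever used) together with v(∅,∅) = 0.

IsMobius : {n : ℕ} → (Subset n → Subset n → ℚ) → (Subset n → Subset n → ℚ) → Set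
IsMobius {n} v m =
  (A A' : Subset n) → Disjoint A A' →
  v A A' ≡
    ΣSub (λ B → ΣSub (λ B' →
      [ disjoint? B B' ×-dec ((B Data.Product., B') ⊑? (A Data.Product., A')) ]⇒ m B B'))

shapleyCoeff : ℕ → ℕ → ℚ
shapleyCoeff n s = ℕ→ℚ ((n ∸ s ∸ 1) ! Data.Nat.* (s !)) * recip (n !)

φ⁺ : {n : ℕ} → (Subset n → Subset n → ℚ) → Fin n → ℚ
φ⁺ {n} v i = ΣSub (λ S → [ ¬? (i ∈? S) ]⇒
  (shapleyCoeff n ∣ S ∣ *
    (v (S ∪ ⁅ i ⁆) (∁ (S ∪ ⁅ i ⁆)) - v S (∁ (S ∪ ⁅ i ⁆)))))

φ⁻ : {n : ℕ} → (Subset n → Subset n → ℚ) → Fin n → ℚ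
φ⁻ {n} v i = ΣSub (λ S → [ ¬? (i ∈? S) ]⇒
  (shapleyCoeff n ∣ S ∣ *
    (v S (∁ (S ∪ ⁅ i ⁆)) - v S (∁ S))))

module Submission where

open import Defs
open import Data.Nat using (ℕ; zero; suc; _∸_; _!; NonZero)
import Data.Nat as ℕ
import Data.Nat.Properties as ℕP
open import Data.Nat.Properties using (_!≢0)
open import Data.Nat.Coprimality using (1-coprimeTo)
import Data.Nat.Coprimality as Coprime
open import Data.Nat.Tactic.RingSolver using (solve-∀)
open import Data.Integer using (+_)
import Data.Integer as ℤ
import Data.Integer.Properties as ℤP
open import Data.Rational using (ℚ; mkℚ; 0ℚ; 1ℚ; _+_; _*_; _-_)
import Data.Rational.Properties as ℚP
open import Data.Rational.Solver using (module +-*-Solver)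
open import Data.Product using (_×_; _,_; proj₁; proj₂)
open import Data.Sum using (inj₁; inj₂; [_,_])
open import Data.Empty using (⊥-elim)
open import Data.Bool using (true; false)
open import Data.List using (List; []; _∷_; _++_; map)
import Data.List.Properties as ListP
open import Data.Vec using ([]; _∷_; here; there)
open import Data.Fin using (Fin; zero; suc)
open import Data.Fin.Subset using (Subset; inside; outside; _⊆_; _∈_; _∉_; _∪_; ⁅_⁆; ∁; ⊥; ∣_∣)
open import Data.Fin.Subset.Properties
  using (_⊆?_; _∈?_; ⊆-refl; ⊥⊆; drop-∷-⊆; p⊆p∪q; p⊆q⇒∁p⊇∁q; x∈⁅x⁆; x∈⁅y⁆⇒x≡y; x∈∁p⇒x∉p;
         x∉p⇒x∈∁p; x∈p∪q⁺; x∈p∪q⁻; x∈p∩q⁺; x∈p∩q⁻; ∪-identityʳ; p⊆q⇒∣p∣≤∣q∣; ∣p∣≤n;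
         ∣∁p∣≡n∸∣p∣; ∣⁅x⁆∣≡1)
open import Function using (_∘_; _⇔_; mk⇔; Equivalence)
open import Relation.Nullary using (Dec; yes; no; does; _because_; ¬_; ¬?; contradiction)
open import Relation.Nullary.Decidable using (_×-dec_)
open import Relation.Nullary.Reflects using (invert)
open import Relation.Binary.PropositionalEquality
  using (_≡_; refl; sym; trans; cong; cong₂; subst; module ≡-Reasoning)

-- Let c(S) = (n-|S|-1)! |S|! / n! be the Shapley weight.  Expanding v in
-- its Möbius transform and exchanging the order of summation gives
--   φ = Σ_{(B,B')} ( Σ_{S ∌ i} c(S) [ 1{(B,B') ⊑ X S} - 1{(B,B') ⊑ Y S} ] ) m(B,B'),
-- with X S = (S ∪ i, N ∖ (S ∪ i)), Y S = (S, N ∖ (S ∪ i)) for φ⁺ and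
-- X S = (S, N ∖ (S ∪ i)), Y S = (S, N ∖ S) for φ⁻.  As Y S ⊑ X S, the bracket is the
-- indicator of "below X S but not below Y S", which holds iff (B,B') satisfies the
-- condition of the proposition and rest B' ⊆ S, where rest B' = N ∖ (B' ∪ i).  So the
-- inner sum is the total weight of the interval rest B' ⊆ S ⊆ N ∖ i, which equals
-- Σ_j C(|B'|, j) c(|rest B'| + j) and telescopes to 1/(n - |B'|) by Pascal's rule
-- for Shapley weights.

ℕ→ℚ-mkℚ : ∀ a → ℕ→ℚ a ≡ mkℚ (+ a) 0 (Coprime.sym (1-coprimeTo a))
ℕ→ℚ-mkℚ a = ℚP.↥p/↧p≡p (mkℚ (+ a) 0 (Coprime.sym (1-coprimeTo a)))

ℕ→ℚ-+ : ∀ a b → ℕ→ℚ (a ℕ.+ b) ≡ ℕ→ℚ a + ℕ→ℚ b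
ℕ→ℚ-+ a b rewrite ℕ→ℚ-mkℚ a | ℕ→ℚ-mkℚ b =
  ℚP./-cong (sym (trans (cong₂ ℤ._+_ (ℤP.*-identityʳ (+ a)) (ℤP.*-identityʳ (+ b)))
                        (sym (ℤP.pos-+ a b)))) refl

ℕ→ℚ-* : ∀ a b → ℕ→ℚ (a ℕ.* b) ≡ ℕ→ℚ a * ℕ→ℚ b
ℕ→ℚ-* a b rewrite ℕ→ℚ-mkℚ a | ℕ→ℚ-mkℚ b = ℚP./-cong (ℤP.pos-* a b) refl

ℕ→ℚ*recip : ∀ B .{{_ : NonZero B}} → ℕ→ℚ B * recip B ≡ 1ℚ
ℕ→ℚ*recip (suc b)
  rewrite ℕ→ℚ-mkℚ (suc b) | ℚP.normalize-coprime {1} {b} (1-coprimeTo (suc b))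
  = ℚP.*-inverseʳ (mkℚ (+ suc b) 0 (Coprime.sym (1-coprimeTo (suc b))))

frac : ℕ → ℕ → ℚ
frac a B = ℕ→ℚ a * recip B

frac-+ : ∀ a c B → frac a B + frac c B ≡ frac (a ℕ.+ c) B
frac-+ a c B = trans (sym (ℚP.*-distribʳ-+ (recip B) (ℕ→ℚ a) (ℕ→ℚ c)))
                     (cong (_* recip B) (sym (ℕ→ℚ-+ a c)))

frac-cross : ∀ a c B D .{{_ : NonZero B}} .{{_ : NonZero D}} →
             a ℕ.* D ≡ c ℕ.* B → frac a B ≡ frac c D
frac-cross a c B D cross = begin
  A * rB              ≡⟨ sym (ℚP.*-identityʳ (A * rB)) ⟩
  A * rB * 1ℚ         ≡⟨ cong (A * rB *_) (sym (ℕ→ℚ*recip D)) ⟩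
  A * rB * (Dq * rD)  ≡⟨ solve 4 (λ A rB Dq rD → A :* rB :* (Dq :* rD) := A :* Dq :* rB :* rD)
                               refl A rB Dq rD ⟩
  A * Dq * rB * rD    ≡⟨ cong (λ x → x * rB * rD) cross-ℚ ⟩
  C * Bq * rB * rD    ≡⟨ solve 4 (λ C Bq rB rD → C :* Bq :* rB :* rD := C :* (Bq :* rB) :* rD)
                               refl C Bq rB rD ⟩
  C * (Bq * rB) * rD  ≡⟨ cong (λ x → C * x * rD) (ℕ→ℚ*recip B) ⟩
  C * 1ℚ * rD         ≡⟨ cong (_* rD) (ℚP.*-identityʳ C) ⟩
  C * rD              ∎
  where
  open ≡-Reasoning
  open +-*-Solver
  A C Bq Dq rB rD : ℚ
  A  = ℕ→ℚ a
  C  = ℕ→ℚ c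
  Bq = ℕ→ℚ B
  Dq = ℕ→ℚ D
  rB = recip B
  rD = recip D
  cross-ℚ : A * Dq ≡ C * Bq
  cross-ℚ = trans (sym (ℕ→ℚ-* a D)) (trans (cong ℕ→ℚ cross) (ℕ→ℚ-* c B))

suc-m+n∸m : ∀ m n → suc (m ℕ.+ n) ∸ m ≡ suc n
suc-m+n∸m zero    n = refl
suc-m+n∸m (suc m) n = suc-m+n∸m m n

shapleyCoeff-closed : ∀ {N} s t → suc (s ℕ.+ t) ≡ N →
                      shapleyCoeff N s ≡ frac (t ! ℕ.* s !) (N !)
shapleyCoeff-closed {N} s t refl =
  cong (λ r → frac ((r ∸ 1) ! ℕ.* s !) (N !)) (suc-m+n∸m s t)

-- Pascal's rule for Shapley weights: c(N+1, s) + c(N+1, s+1) = c(N, s), since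
-- (t+1)! s! + t! (s+1)! = (N+1) t! s!  when N = s + t + 1.
shapleyCoeff-pascal : ∀ N s → s ℕ.< N →
  shapleyCoeff (suc N) s + shapleyCoeff (suc N) (suc s) ≡ shapleyCoeff N s
shapleyCoeff-pascal N s s<N with ℕP.m≤n⇒∃[o]m+o≡n s<N
... | t , refl = begin
  shapleyCoeff (suc N) s + shapleyCoeff (suc N) (suc s)
    ≡⟨ cong₂ _+_ (shapleyCoeff-closed s (suc t) (cong suc (ℕP.+-suc s t)))
                 (shapleyCoeff-closed (suc s) t refl) ⟩
  frac (suc t ! ℕ.* s !) (suc N !) + frac (t ! ℕ.* suc s !) (suc N !)
    ≡⟨ frac-+ (suc t ! ℕ.* s !) (t ! ℕ.* suc s !) (suc N !) ⟩
  frac (suc t ! ℕ.* s ! ℕ.+ t ! ℕ.* suc s !) (suc N !)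
    ≡⟨ frac-cross (suc t ! ℕ.* s ! ℕ.+ t ! ℕ.* suc s !) (t ! ℕ.* s !) (suc N !) (N !)
                  {{suc N !≢0}} {{N !≢0}} (cross s t (t !) (s !) (N !)) ⟩
  frac (t ! ℕ.* s !) (N !)
    ≡⟨ sym (shapleyCoeff-closed s t refl) ⟩
  shapleyCoeff N s ∎
  where
  open ≡-Reasoning
  cross : ∀ s t x y F → (suc t ℕ.* x ℕ.* y ℕ.+ x ℕ.* (suc s ℕ.* y)) ℕ.* F
                        ≡ x ℕ.* y ℕ.* (suc (suc (s ℕ.+ t)) ℕ.* F)
  cross = solve-∀

shapleyCoeff-last : ∀ k → shapleyCoeff (suc k) k ≡ recip (suc k)
shapleyCoeff-last k = begin
  shapleyCoeff (suc k) k     ≡⟨ shapleyCoeff-closed k 0 (cong suc (ℕP.+-identityʳ k)) ⟩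
  frac (1 ℕ.* k !) (suc k !) ≡⟨ frac-cross (1 ℕ.* k !) 1 (suc k !) (suc k) {{suc k !≢0}}
                                           (cross k (k !)) ⟩
  frac 1 (suc k)             ≡⟨ ℚP.*-identityˡ (recip (suc k)) ⟩
  recip (suc k)              ∎
  where
  open ≡-Reasoning
  cross : ∀ k x → 1 ℕ.* x ℕ.* suc k ≡ 1 ℕ.* (x ℕ.+ k ℕ.* x)
  cross = solve-∀

-- binomialSum m h = Σ_{j=0}^{m} C(m,j) h(j), defined through Pascal's rule
-- C(m+1,j) = C(m,j) + C(m,j-1); such sums arise from intervals of sets.
binomialSum : ℕ → (ℕ → ℚ) → ℚ
binomialSum zero    h = h 0
binomialSum (suc m) h = binomialSum m h + binomialSum m (λ j → h (suc j))

binomialSum-cong : ∀ m {g h : ℕ → ℚ} → (∀ j → j ℕ.≤ m → g j ≡ h j) →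
                   binomialSum m g ≡ binomialSum m h
binomialSum-cong zero    g≗h = g≗h 0 ℕ.z≤n
binomialSum-cong (suc m) g≗h =
  cong₂ _+_ (binomialSum-cong m (λ j j≤m → g≗h j (ℕP.m≤n⇒m≤1+n j≤m)))
            (binomialSum-cong m (λ j j≤m → g≗h (suc j) (ℕ.s≤s j≤m)))

binomialSum-+ : ∀ m (g h : ℕ → ℚ) →
                binomialSum m (λ j → g j + h j) ≡ binomialSum m g + binomialSum m h
binomialSum-+ zero    g h = refl
binomialSum-+ (suc m) g h
  rewrite binomialSum-+ m g h | binomialSum-+ m (λ j → g (suc j)) (λ j → h (suc j))
  = solve 4 (λ a b c d → (a :+ b) :+ (c :+ d) := (a :+ c) :+ (b :+ d)) refl
      (binomialSum m g) (binomialSum m h)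
      (binomialSum m (λ j → g (suc j))) (binomialSum m (λ j → h (suc j)))
  where open +-*-Solver

-- Induction on b: regroup the terms of C(b+1,·) by Pascal's rule for C, then merge
-- neighbouring weights by Pascal's rule for c.
shapley-binomial : ∀ b k →
  binomialSum b (λ j → shapleyCoeff (suc (b ℕ.+ k)) (j ℕ.+ k)) ≡ recip (suc k)
shapley-binomial zero    k = shapleyCoeff-last k
shapley-binomial (suc b) k = begin
  binomialSum b h + binomialSum b (λ j → h (suc j))
    ≡⟨ sym (binomialSum-+ b h (λ j → h (suc j))) ⟩
  binomialSum b (λ j → h j + h (suc j))
    ≡⟨ binomialSum-cong b (λ j j≤b →
         shapleyCoeff-pascal (suc (b ℕ.+ k)) (j ℕ.+ k) (ℕ.s≤s (ℕP.+-monoˡ-≤ k j≤b))) ⟩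
  binomialSum b (λ j → shapleyCoeff (suc (b ℕ.+ k)) (j ℕ.+ k))
    ≡⟨ shapley-binomial b k ⟩
  recip (suc k) ∎
  where
  open ≡-Reasoning
  h : ℕ → ℚ
  h j = shapleyCoeff (suc (suc b ℕ.+ k)) (j ℕ.+ k)

module _ {A : Set} where
  open +-*-Solver

  Σ[_] : List A → (A → ℚ) → ℚ
  Σ[ xs ] f = sumℚ (map f xs)

  Σ-cong : ∀ xs {f g : A → ℚ} → (∀ x → f x ≡ g x) → Σ[ xs ] f ≡ Σ[ xs ] g
  Σ-cong xs f≗g = cong sumℚ (ListP.map-cong f≗g xs)

  Σ-zero : ∀ xs {f : A → ℚ} → (∀ x → f x ≡ 0ℚ) → Σ[ xs ] f ≡ 0ℚ
  Σ-zero []       f≗0 = refl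
  Σ-zero (x ∷ xs) f≗0 rewrite f≗0 x | Σ-zero xs f≗0 = refl

  Σ-+ : ∀ xs (f g : A → ℚ) → Σ[ xs ] (λ x → f x + g x) ≡ Σ[ xs ] f + Σ[ xs ] g
  Σ-+ []       f g = refl
  Σ-+ (x ∷ xs) f g rewrite Σ-+ xs f g =
    solve 4 (λ a b c d → (a :+ b) :+ (c :+ d) := (a :+ c) :+ (b :+ d)) refl
      (f x) (g x) (Σ[ xs ] f) (Σ[ xs ] g)

  Σ-*ʳ : ∀ xs (f : A → ℚ) (k : ℚ) → Σ[ xs ] (λ x → f x * k) ≡ Σ[ xs ] f * k
  Σ-*ʳ []       f k = sym (ℚP.*-zeroˡ k)
  Σ-*ʳ (x ∷ xs) f k rewrite Σ-*ʳ xs f k = sym (ℚP.*-distribʳ-+ k (f x) (Σ[ xs ] f))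

  Σ-linear : ∀ xs (k : ℚ) (f g : A → ℚ) →
             k * (Σ[ xs ] f - Σ[ xs ] g) ≡ Σ[ xs ] (λ x → k * (f x - g x))
  Σ-linear []       k f g = solve 1 (λ k → k :* (con 0ℚ :- con 0ℚ) := con 0ℚ) refl k
  Σ-linear (x ∷ xs) k f g rewrite sym (Σ-linear xs k f g) =
    solve 5 (λ k a b c d → k :* ((a :+ b) :- (c :+ d)) := k :* (a :- c) :+ k :* (b :- d)) refl
      k (f x) (Σ[ xs ] f) (g x) (Σ[ xs ] g)

  Σ-++ : ∀ xs ys (f : A → ℚ) → Σ[ xs ++ ys ] f ≡ Σ[ xs ] f + Σ[ ys ] f
  Σ-++ []       ys f = sym (ℚP.+-identityˡ (Σ[ ys ] f))
  Σ-++ (x ∷ xs) ys f rewrite Σ-++ xs ys f = sym (ℚP.+-assoc (f x) (Σ[ xs ] f) (Σ[ ys ] f))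

module _ {A B : Set} where

  Σ-swap : ∀ (xs : List A) (ys : List B) (f : A → B → ℚ) →
           Σ[ xs ] (λ x → Σ[ ys ] (f x)) ≡ Σ[ ys ] (λ y → Σ[ xs ] (λ x → f x y))
  Σ-swap []       ys f = sym (Σ-zero ys (λ _ → refl))
  Σ-swap (x ∷ xs) ys f rewrite Σ-swap xs ys f = sym (Σ-+ ys (f x) (λ y → Σ[ xs ] (λ x → f x y)))

  Σ-map : ∀ (xs : List A) (g : A → B) (f : B → ℚ) → Σ[ map g xs ] f ≡ Σ[ xs ] (λ x → f (g x))
  Σ-map xs g f = cong sumℚ (sym (ListP.map-∘ xs))

ΣSub-suc : ∀ n (f : Subset (suc n) → ℚ) →
  ΣSub f ≡ ΣSub (λ X → f (outside ∷ X)) + ΣSub (λ X → f (inside ∷ X))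
ΣSub-suc n f = trans (Σ-++ (map (outside ∷_) (allSubsets n)) (map (inside ∷_) (allSubsets n)) f)
                     (cong₂ _+_ (Σ-map (allSubsets n) (outside ∷_) f)
                                (Σ-map (allSubsets n) (inside ∷_) f))

module _ {P : Set} where

  χ : Dec P → ℚ
  χ d = [ d ]⇒ 1ℚ

  []⇒-χ : (p : Dec P) (q : ℚ) → [ p ]⇒ q ≡ χ p * q
  []⇒-χ (true  because _) q = sym (ℚP.*-identityˡ q)
  []⇒-χ (false because _) q = sym (ℚP.*-zeroˡ q)

  []⇒-*ʳ : (p : Dec P) (x y : ℚ) → [ p ]⇒ (x * y) ≡ ([ p ]⇒ x) * y
  []⇒-*ʳ (true  because _) x y = refl
  []⇒-*ʳ (false because _) x y = sym (ℚP.*-zeroˡ y)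

  []⇒-no : ¬ P → (p : Dec P) (q : ℚ) → [ p ]⇒ q ≡ 0ℚ
  []⇒-no ¬P (true  because [P]) q = contradiction (invert [P]) ¬P
  []⇒-no ¬P (false because _)   q = refl

  Σ-[]⇒ : ∀ {A : Set} (xs : List A) (p : Dec P) (f : A → ℚ) →
          Σ[ xs ] (λ x → [ p ]⇒ f x) ≡ [ p ]⇒ Σ[ xs ] f
  Σ-[]⇒ xs (true  because _) f = refl
  Σ-[]⇒ xs (false because _) f = Σ-zero xs (λ _ → refl)

  []⇒-guard : (p : Dec P) {x y : ℚ} → (P → x ≡ y) → [ p ]⇒ x ≡ [ p ]⇒ y
  []⇒-guard (true  because [P]) x≡y = x≡y (invert [P])
  []⇒-guard (false because _)   x≡y = refl

module _ {P Q : Set} where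

  []⇒-does : (p : Dec P) (q : Dec Q) (r : ℚ) → does p ≡ does q → [ p ]⇒ r ≡ [ q ]⇒ r
  []⇒-does (true  because _) (true  because _) r _  = refl
  []⇒-does (false because _) (false because _) r _  = refl
  []⇒-does (true  because _) (false because _) r ()
  []⇒-does (false because _) (true  because _) r ()

  []⇒-⇔ : (P → Q) → (Q → P) → (p : Dec P) (q : Dec Q) (r : ℚ) → [ p ]⇒ r ≡ [ q ]⇒ r
  []⇒-⇔ P⇒Q Q⇒P p q r with p | q
  ... | true  because _    | true  because _    = refl
  ... | false because _    | false because _    = refl
  ... | true  because [P]  | false because [¬Q] = contradiction (P⇒Q (invert [P])) (invert [¬Q])
  ... | false because [¬P] | true  because [Q]  = contradiction (Q⇒P (invert [Q])) (invert [¬P])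

  []⇒-× : (p : Dec P) (q : Dec Q) (r : ℚ) → [ p ×-dec q ]⇒ r ≡ [ p ]⇒ ([ q ]⇒ r)
  []⇒-× (true  because _) (true  because _) r = refl
  []⇒-× (true  because _) (false because _) r = refl
  []⇒-× (false because _) q                 r = refl

  χ-difference : (Q → P) → (p : Dec P) (q : Dec Q) → χ p - χ q ≡ χ (p ×-dec ¬? q)
  χ-difference Q⇒P p q with p | q
  ... | true  because _    | true  because _   = ℚP.+-inverseʳ 1ℚ
  ... | true  because _    | false because _   = ℚP.+-identityʳ 1ℚ
  ... | false because _    | false because _   = refl
  ... | false because [¬P] | true  because [Q] = contradiction (Q⇒P (invert [Q])) (invert [¬P])

  []⇒-*-χ : (p : Dec P) (q : Dec Q) (c : ℚ) → ([ p ]⇒ c) * χ q ≡ [ q ×-dec p ]⇒ c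
  []⇒-*-χ (true  because _) (true  because _) c = ℚP.*-identityʳ c
  []⇒-*-χ (false because _) (true  because _) c = ℚP.*-zeroˡ 1ℚ
  []⇒-*-χ p                 (false because _) c = ℚP.*-zeroʳ ([ p ]⇒ c)

zero∉outside∷ : ∀ {n} {p : Subset n} → zero ∉ outside ∷ p
zero∉outside∷ ()

interval-tail : ∀ {n} a b c (L U : Subset n) (h : Subset n → ℚ) →
  (∀ X → does ((a ∷ L) ⊆? (b ∷ X) ×-dec (b ∷ X) ⊆? (c ∷ U)) ≡ does (L ⊆? X ×-dec X ⊆? U)) →
  ΣSub (λ X → [ (a ∷ L) ⊆? (b ∷ X) ×-dec (b ∷ X) ⊆? (c ∷ U) ]⇒ h X)
    ≡ ΣSub (λ X → [ L ⊆? X ×-dec X ⊆? U ]⇒ h X)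
interval-tail a b c L U h same =
  Σ-cong (allSubsets _) (λ X →
    []⇒-does ((a ∷ L) ⊆? (b ∷ X) ×-dec (b ∷ X) ⊆? (c ∷ U)) (L ⊆? X ×-dec X ⊆? U) (h X) (same X))

interval-void : ∀ {n} a b c (L U : Subset n) (h : Subset n → ℚ) →
  (∀ {X} → ¬ ((a ∷ L) ⊆ (b ∷ X) × (b ∷ X) ⊆ (c ∷ U))) →
  ΣSub (λ X → [ (a ∷ L) ⊆? (b ∷ X) ×-dec (b ∷ X) ⊆? (c ∷ U) ]⇒ h X) ≡ 0ℚ
interval-void a b c L U h fails =
  Σ-zero (allSubsets _) (λ X → []⇒-no fails ((a ∷ L) ⊆? (b ∷ X) ×-dec (b ∷ X) ⊆? (c ∷ U)) (h X))

interval-sum : ∀ {n} (L U : Subset n) → L ⊆ U → (g : ℕ → ℚ) →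
  ΣSub (λ X → [ L ⊆? X ×-dec X ⊆? U ]⇒ g ∣ X ∣)
    ≡ binomialSum (∣ U ∣ ∸ ∣ L ∣) (λ j → g (j ℕ.+ ∣ L ∣))
interval-sum []            []            _   g = ℚP.+-identityʳ (g 0)
interval-sum {suc n} (outside ∷ L) (outside ∷ U) L⊆U g =
  trans (ΣSub-suc n _)
    (trans (cong₂ _+_
             (trans (interval-tail outside outside outside L U (λ X → g ∣ X ∣) (λ _ → refl))
                    (interval-sum L U (drop-∷-⊆ L⊆U) g))
             (interval-void outside inside outside L U (λ X → g (suc ∣ X ∣))
                            (λ (_ , X⊆U) → zero∉outside∷ (X⊆U here))))
           (ℚP.+-identityʳ _))
interval-sum {suc n} (inside ∷ L) (inside ∷ U) L⊆U g =
  trans (ΣSub-suc n _)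
    (trans (cong₂ _+_
             (interval-void inside outside inside L U (λ X → g ∣ X ∣)
                            (λ (L⊆X , _) → zero∉outside∷ (L⊆X here)))
             (trans (interval-tail inside inside inside L U (λ X → g (suc ∣ X ∣)) (λ _ → refl))
                    (interval-sum L U (drop-∷-⊆ L⊆U) (λ k → g (suc k)))))
    (trans (ℚP.+-identityˡ _)
           (binomialSum-cong (∣ U ∣ ∸ ∣ L ∣) (λ j _ → cong g (sym (ℕP.+-suc j ∣ L ∣))))))
interval-sum {suc n} (outside ∷ L) (inside ∷ U) L⊆U g
  rewrite ℕP.+-∸-assoc 1 (p⊆q⇒∣p∣≤∣q∣ (drop-∷-⊆ L⊆U)) =
  trans (ΣSub-suc n _)
    (cong₂ _+_
      (trans (interval-tail outside outside inside L U (λ X → g ∣ X ∣) (λ _ → refl))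
             (interval-sum L U (drop-∷-⊆ L⊆U) g))
      (trans (interval-tail outside inside inside L U (λ X → g (suc ∣ X ∣)) (λ _ → refl))
             (interval-sum L U (drop-∷-⊆ L⊆U) (λ k → g (suc k)))))
interval-sum (inside ∷ L) (outside ∷ U) L⊆U g = contradiction (L⊆U here) zero∉outside∷

∣p∪⁅x⁆∣ : ∀ {n} (x : Fin n) (p : Subset n) → x ∉ p → ∣ p ∪ ⁅ x ⁆ ∣ ≡ suc ∣ p ∣
∣p∪⁅x⁆∣ zero    (outside ∷ p) _   = cong (λ q → suc ∣ q ∣) (∪-identityʳ p)
∣p∪⁅x⁆∣ zero    (inside  ∷ p) x∉p = contradiction here x∉p
∣p∪⁅x⁆∣ (suc x) (outside ∷ p) x∉p = ∣p∪⁅x⁆∣ x p (x∉p ∘ there)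
∣p∪⁅x⁆∣ (suc x) (inside  ∷ p) x∉p = cong suc (∣p∪⁅x⁆∣ x p (x∉p ∘ there))

∉∪ : ∀ {n} {x : Fin n} {p q : Subset n} → x ∉ p → x ∉ q → x ∉ p ∪ q
∉∪ {p = p} {q} x∉p x∉q = [ x∉p , x∉q ] ∘ x∈p∪q⁻ p q

disjoint-∉ : ∀ {n} {x : Fin n} {p q : Subset n} → Disjoint p q → x ∈ p → x ∉ q
disjoint-∉ {x = x} p∩q=∅ x∈p x∈q = p∩q=∅ (x , x∈p∩q⁺ (x∈p , x∈q))

disjoint-∁ : ∀ {n} {p q : Subset n} → p ⊆ q → Disjoint p (∁ q)
disjoint-∁ p⊆q (x , x∈p∩∁q) with x∈p∩q⁻ _ _ x∈p∩∁q
... | x∈p , x∈∁q = x∈∁p⇒x∉p x∈∁q (p⊆q x∈p)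

Below : ∀ {n} (B B' A A' : Subset n) → Set
Below B B' A A' = Disjoint B B' × ((B , B') ⊑ (A , A'))

below? : ∀ {n} (B B' A A' : Subset n) → Dec (Below B B' A A')
below? B B' A A' = disjoint? B B' ×-dec ((B , B') ⊑? (A , A'))

module MobiusExpansion {n : ℕ} (v m : Subset n → Subset n → ℚ) (mobius : IsMobius v m) where

  mobius-χ : ∀ A A' → Disjoint A A' →
    v A A' ≡ ΣSub (λ B → ΣSub (λ B' → χ (below? B B' A A') * m B B'))
  mobius-χ A A' A∩A'=∅ =
    trans (mobius A A' A∩A'=∅)
          (Σ-cong (allSubsets n) (λ B → Σ-cong (allSubsets n) (λ B' →
            []⇒-χ (below? B B' A A') (m B B'))))

  mobius-difference : (w : Subset n → ℚ) (X₁ X₂ Y₁ Y₂ : Subset n → Subset n) →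
    (∀ S → Disjoint (X₁ S) (X₂ S)) → (∀ S → Disjoint (Y₁ S) (Y₂ S)) →
    ΣSub (λ S → w S * (v (X₁ S) (X₂ S) - v (Y₁ S) (Y₂ S)))
      ≡ ΣSub (λ B → ΣSub (λ B' →
          ΣSub (λ S → w S * (χ (below? B B' (X₁ S) (X₂ S)) - χ (below? B B' (Y₁ S) (Y₂ S))))
            * m B B'))
  mobius-difference w X₁ X₂ Y₁ Y₂ X-disjoint Y-disjoint = begin
    ΣSub (λ S → w S * (v (X₁ S) (X₂ S) - v (Y₁ S) (Y₂ S)))
      ≡⟨ Σ-cong subsets expand ⟩
    ΣSub (λ S → ΣSub (λ B → ΣSub (λ B' → K S B B' * m B B')))
      ≡⟨ Σ-swap subsets subsets (λ S B → ΣSub (λ B' → K S B B' * m B B')) ⟩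
    ΣSub (λ B → ΣSub (λ S → ΣSub (λ B' → K S B B' * m B B')))
      ≡⟨ Σ-cong subsets (λ B → Σ-swap subsets subsets (λ S B' → K S B B' * m B B')) ⟩
    ΣSub (λ B → ΣSub (λ B' → ΣSub (λ S → K S B B' * m B B')))
      ≡⟨ Σ-cong subsets (λ B → Σ-cong subsets (λ B' → Σ-*ʳ subsets (λ S → K S B B') (m B B'))) ⟩
    ΣSub (λ B → ΣSub (λ B' → ΣSub (λ S → K S B B') * m B B')) ∎
    where
    open ≡-Reasoning
    subsets : List (Subset n)
    subsets = allSubsets n

    a b K : Subset n → Subset n → Subset n → ℚ
    a S B B' = χ (below? B B' (X₁ S) (X₂ S))
    b S B B' = χ (below? B B' (Y₁ S) (Y₂ S))
    K S B B' = w S * (a S B B' - b S B B')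

    factor-m : ∀ w a b μ → w * (a * μ - b * μ) ≡ w * (a - b) * μ
    factor-m = solve 4 (λ w a b μ → w :* (a :* μ :- b :* μ) := w :* (a :- b) :* μ) refl
      where open +-*-Solver

    expand : ∀ S → w S * (v (X₁ S) (X₂ S) - v (Y₁ S) (Y₂ S))
                   ≡ ΣSub (λ B → ΣSub (λ B' → K S B B' * m B B'))
    expand S = begin
      w S * (v (X₁ S) (X₂ S) - v (Y₁ S) (Y₂ S))
        ≡⟨ cong₂ (λ x y → w S * (x - y)) (mobius-χ (X₁ S) (X₂ S) (X-disjoint S))
                                         (mobius-χ (Y₁ S) (Y₂ S) (Y-disjoint S)) ⟩
      w S * (ΣSub (λ B → ΣSub (λ B' → a S B B' * m B B'))
             - ΣSub (λ B → ΣSub (λ B' → b S B B' * m B B')))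
        ≡⟨ Σ-linear subsets (w S) (λ B → ΣSub (λ B' → a S B B' * m B B'))
                                  (λ B → ΣSub (λ B' → b S B B' * m B B')) ⟩
      ΣSub (λ B → w S * (ΣSub (λ B' → a S B B' * m B B') - ΣSub (λ B' → b S B B' * m B B')))
        ≡⟨ Σ-cong subsets (λ B → Σ-linear subsets (w S) (λ B' → a S B B' * m B B')
                                                        (λ B' → b S B B' * m B B')) ⟩
      ΣSub (λ B → ΣSub (λ B' → w S * (a S B B' * m B B' - b S B B' * m B B')))
        ≡⟨ Σ-cong subsets (λ B → Σ-cong subsets (λ B' →
             factor-m (w S) (a S B B') (b S B B') (m B B'))) ⟩
      ΣSub (λ B → ΣSub (λ B' → K S B B' * m B B')) ∎

module Player {n : ℕ} (i : Fin n) where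

  U : Subset n
  U = ∁ ⁅ i ⁆

  ⊆U⇒∌i : ∀ {S} → S ⊆ U → i ∉ S
  ⊆U⇒∌i S⊆U i∈S = x∈∁p⇒x∉p (S⊆U i∈S) (x∈⁅x⁆ i)

  ∌i⇒⊆U : ∀ {S} → i ∉ S → S ⊆ U
  ∌i⇒⊆U i∉S x∈S = x∉p⇒x∈∁p (λ x∈⁅i⁆ → i∉S (subst (_∈ _) (x∈⁅y⁆⇒x≡y i x∈⁅i⁆) x∈S))

  rest : Subset n → Subset n
  rest B' = ∁ (B' ∪ ⁅ i ⁆)

  ∈rest⁺ : ∀ {B' x} → x ∉ B' → x ∉ ⁅ i ⁆ → x ∈ rest B'
  ∈rest⁺ x∉B' x∉⁅i⁆ = x∉p⇒x∈∁p (∉∪ x∉B' x∉⁅i⁆)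

  ∈rest⁻ : ∀ {B' x} → x ∈ rest B' → x ∉ B' × x ∉ ⁅ i ⁆
  ∈rest⁻ x∈rest = (λ x∈B' → x∈∁p⇒x∉p x∈rest (x∈p∪q⁺ (inj₁ x∈B')))
                , (λ x∈⁅i⁆ → x∈∁p⇒x∉p x∈rest (x∈p∪q⁺ (inj₂ x∈⁅i⁆)))

  rest⊆U : ∀ B' → rest B' ⊆ U
  rest⊆U B' = x∉p⇒x∈∁p ∘ proj₂ ∘ ∈rest⁻

  rest⊆⇔ : ∀ B' S → rest B' ⊆ S ⇔ ∁ (S ∪ ⁅ i ⁆) ⊆ B'
  rest⊆⇔ B' S = mk⇔ to from
    where
    to : rest B' ⊆ S → ∁ (S ∪ ⁅ i ⁆) ⊆ B'
    to rest⊆S {x} x∈∁ with x ∈? B'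
    ... | yes x∈B' = x∈B'
    ... | no  x∉B' = contradiction (x∈p∪q⁺ (inj₁ (rest⊆S (∈rest⁺ x∉B' x∉⁅i⁆)))) (x∈∁p⇒x∉p x∈∁)
      where
      x∉⁅i⁆ : x ∉ ⁅ i ⁆
      x∉⁅i⁆ x∈⁅i⁆ = x∈∁p⇒x∉p x∈∁ (x∈p∪q⁺ (inj₂ x∈⁅i⁆))
    from : ∁ (S ∪ ⁅ i ⁆) ⊆ B' → rest B' ⊆ S
    from ∁⊆B' {x} x∈rest with x ∈? S
    ... | yes x∈S = x∈S
    ... | no  x∉S = contradiction (∁⊆B' (x∉p⇒x∈∁p (∉∪ x∉S (proj₂ (∈rest⁻ x∈rest)))))
                                  (proj₁ (∈rest⁻ x∈rest))

  rest-size : ∀ B' → i ∉ B' → suc (∣ B' ∣ ℕ.+ ∣ rest B' ∣) ≡ n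
  rest-size B' i∉B' = trans (cong (λ l → suc (∣ B' ∣ ℕ.+ l)) ∣rest∣≡)
                            (ℕP.m+[n∸m]≡n (subst (ℕ._≤ n) ∣B'∪⁅i⁆∣≡ (∣p∣≤n (B' ∪ ⁅ i ⁆))))
    where
    ∣B'∪⁅i⁆∣≡ : ∣ B' ∪ ⁅ i ⁆ ∣ ≡ suc ∣ B' ∣
    ∣B'∪⁅i⁆∣≡ = ∣p∪⁅x⁆∣ i B' i∉B'
    ∣rest∣≡ : ∣ rest B' ∣ ≡ n ∸ suc ∣ B' ∣
    ∣rest∣≡ = trans (∣∁p∣≡n∸∣p∣ (B' ∪ ⁅ i ⁆)) (cong (n ∸_) ∣B'∪⁅i⁆∣≡)

  ∣U∣≡ : ∀ B' → i ∉ B' → ∣ U ∣ ≡ ∣ B' ∣ ℕ.+ ∣ rest B' ∣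
  ∣U∣≡ B' i∉B' = trans (∣∁p∣≡n∸∣p∣ ⁅ i ⁆)
                       (trans (cong (n ∸_) (∣⁅x⁆∣≡1 i)) (cong (_∸ 1) (sym (rest-size B' i∉B'))))

  shapley-interval : ∀ B' → B' ⊆ U →
    ΣSub (λ S → [ rest B' ⊆? S ×-dec S ⊆? U ]⇒ shapleyCoeff n ∣ S ∣) ≡ recip (n ∸ ∣ B' ∣)
  shapley-interval B' B'⊆U = begin
    ΣSub (λ S → [ rest B' ⊆? S ×-dec S ⊆? U ]⇒ shapleyCoeff n ∣ S ∣)
      ≡⟨ interval-sum (rest B') U (rest⊆U B') (shapleyCoeff n) ⟩
    binomialSum (∣ U ∣ ∸ l) (λ j → shapleyCoeff n (j ℕ.+ l))
      ≡⟨ cong (λ k → binomialSum k (λ j → shapleyCoeff n (j ℕ.+ l)))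
              (trans (cong (_∸ l) (∣U∣≡ B' i∉B')) (ℕP.m+n∸n≡m b l)) ⟩
    binomialSum b (λ j → shapleyCoeff n (j ℕ.+ l))
      ≡⟨ cong (λ N → binomialSum b (λ j → shapleyCoeff N (j ℕ.+ l))) (sym (rest-size B' i∉B')) ⟩
    binomialSum b (λ j → shapleyCoeff (suc (b ℕ.+ l)) (j ℕ.+ l))
      ≡⟨ shapley-binomial b l ⟩
    recip (suc l)
      ≡⟨ cong recip (sym (trans (cong (_∸ b) (sym (rest-size B' i∉B'))) (suc-m+n∸m b l))) ⟩
    recip (n ∸ b) ∎
    where
    open ≡-Reasoning
    i∉B' : i ∉ B'
    i∉B' = ⊆U⇒∌i B'⊆U
    b l : ℕ
    b = ∣ B' ∣
    l = ∣ rest B' ∣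

  below-join : ∀ B B' S → Below B B' S (∁ (S ∪ ⁅ i ⁆)) → Below B B' (S ∪ ⁅ i ⁆) (∁ (S ∪ ⁅ i ⁆))
  below-join B B' S (B∩B'=∅ , B⊆S , ∁⊆B') = B∩B'=∅ , p⊆p∪q ⁅ i ⁆ ∘ B⊆S , ∁⊆B'

  below-leave : ∀ B B' S → Below B B' S (∁ S) → Below B B' S (∁ (S ∪ ⁅ i ⁆))
  below-leave B B' S (B∩B'=∅ , B⊆S , ∁S⊆B') =
    B∩B'=∅ , B⊆S , ∁S⊆B' ∘ p⊆q⇒∁p⊇∁q (p⊆p∪q ⁅ i ⁆)

  marginal⁺ : ∀ B B' S →
    ((Below B B' (S ∪ ⁅ i ⁆) (∁ (S ∪ ⁅ i ⁆)) × ¬ Below B B' S (∁ (S ∪ ⁅ i ⁆))) × i ∉ S)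
      ⇔ ((Disjoint B B' × (⁅ i ⁆ ⊆ B × B' ⊆ U)) × (rest B' ⊆ S × S ⊆ U))
  marginal⁺ B B' S = mk⇔ to from
    where
    to : (Below B B' (S ∪ ⁅ i ⁆) (∁ (S ∪ ⁅ i ⁆)) × ¬ Below B B' S (∁ (S ∪ ⁅ i ⁆))) × i ∉ S →
         (Disjoint B B' × (⁅ i ⁆ ⊆ B × B' ⊆ U)) × (rest B' ⊆ S × S ⊆ U)
    to (((B∩B'=∅ , B⊆S∪i , ∁⊆B') , not-below) , i∉S) =
      (B∩B'=∅ , ⁅i⁆⊆B , ∌i⇒⊆U (disjoint-∉ B∩B'=∅ i∈B))
      , (Equivalence.from (rest⊆⇔ B' S) ∁⊆B' , ∌i⇒⊆U i∉S)
      where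
      -- if i ∉ B then B ⊆ S, so (B,B') would already lie below (S, N ∖ (S ∪ i))
      i∈B : i ∈ B
      i∈B with i ∈? B
      ... | yes i∈B = i∈B
      ... | no  i∉B = ⊥-elim (not-below (B∩B'=∅ , B⊆S , ∁⊆B'))
        where
        B⊆S : B ⊆ S
        B⊆S x∈B with x∈p∪q⁻ S ⁅ i ⁆ (B⊆S∪i x∈B)
        ... | inj₁ x∈S   = x∈S
        ... | inj₂ x∈⁅i⁆ = contradiction (subst (_∈ B) (x∈⁅y⁆⇒x≡y i x∈⁅i⁆) x∈B) i∉B
      ⁅i⁆⊆B : ⁅ i ⁆ ⊆ B
      ⁅i⁆⊆B x∈⁅i⁆ = subst (_∈ B) (sym (x∈⁅y⁆⇒x≡y i x∈⁅i⁆)) i∈B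
    from : (Disjoint B B' × (⁅ i ⁆ ⊆ B × B' ⊆ U)) × (rest B' ⊆ S × S ⊆ U) →
           (Below B B' (S ∪ ⁅ i ⁆) (∁ (S ∪ ⁅ i ⁆)) × ¬ Below B B' S (∁ (S ∪ ⁅ i ⁆))) × i ∉ S
    from ((B∩B'=∅ , ⁅i⁆⊆B , _) , rest⊆S , S⊆U) =
      ((B∩B'=∅ , B⊆S∪i , Equivalence.to (rest⊆⇔ B' S) rest⊆S) , not-below) , ⊆U⇒∌i S⊆U
      where
      B⊆S∪i : B ⊆ S ∪ ⁅ i ⁆
      B⊆S∪i {x} x∈B with x ∈? ⁅ i ⁆
      ... | yes x∈⁅i⁆ = x∈p∪q⁺ (inj₂ x∈⁅i⁆)
      ... | no  x∉⁅i⁆ = x∈p∪q⁺ (inj₁ (rest⊆S (∈rest⁺ (disjoint-∉ B∩B'=∅ x∈B) x∉⁅i⁆)))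
      not-below : ¬ Below B B' S (∁ (S ∪ ⁅ i ⁆))
      not-below (_ , B⊆S , _) = ⊆U⇒∌i S⊆U (B⊆S (⁅i⁆⊆B (x∈⁅x⁆ i)))

  marginal⁻ : ∀ B B' S →
    ((Below B B' S (∁ (S ∪ ⁅ i ⁆)) × ¬ Below B B' S (∁ S)) × i ∉ S)
      ⇔ (((Disjoint B B' × (B ⊆ U × B' ⊆ U)) × (⊥ ⊆ B × B' ⊆ U)) × (rest B' ⊆ S × S ⊆ U))
  marginal⁻ B B' S = mk⇔ to from
    where
    to : (Below B B' S (∁ (S ∪ ⁅ i ⁆)) × ¬ Below B B' S (∁ S)) × i ∉ S →
         ((Disjoint B B' × (B ⊆ U × B' ⊆ U)) × (⊥ ⊆ B × B' ⊆ U)) × (rest B' ⊆ S × S ⊆ U)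
    to (((B∩B'=∅ , B⊆S , ∁⊆B') , not-below) , i∉S) =
      ((B∩B'=∅ , ∌i⇒⊆U i∉S ∘ B⊆S , ∌i⇒⊆U i∉B') , ⊥⊆ , ∌i⇒⊆U i∉B')
      , (Equivalence.from (rest⊆⇔ B' S) ∁⊆B' , ∌i⇒⊆U i∉S)
      where
      -- if i ∈ B' then N ∖ S ⊆ B', so (B,B') would already lie below (S, N ∖ S)
      i∉B' : i ∉ B'
      i∉B' i∈B' = not-below (B∩B'=∅ , B⊆S , ∁S⊆B')
        where
        ∁S⊆B' : ∁ S ⊆ B'
        ∁S⊆B' {x} x∈∁S with x ∈? ⁅ i ⁆
        ... | yes x∈⁅i⁆ = subst (_∈ B') (sym (x∈⁅y⁆⇒x≡y i x∈⁅i⁆)) i∈B'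
        ... | no  x∉⁅i⁆ = ∁⊆B' (x∉p⇒x∈∁p (∉∪ (x∈∁p⇒x∉p x∈∁S) x∉⁅i⁆))
    from : ((Disjoint B B' × (B ⊆ U × B' ⊆ U)) × (⊥ ⊆ B × B' ⊆ U)) × (rest B' ⊆ S × S ⊆ U) →
           (Below B B' S (∁ (S ∪ ⁅ i ⁆)) × ¬ Below B B' S (∁ S)) × i ∉ S
    from (((B∩B'=∅ , B⊆U , B'⊆U) , _) , rest⊆S , S⊆U) =
      ((B∩B'=∅ , B⊆S , Equivalence.to (rest⊆⇔ B' S) rest⊆S) , not-below) , ⊆U⇒∌i S⊆U
      where
      B⊆S : B ⊆ S
      B⊆S x∈B = rest⊆S (∈rest⁺ (disjoint-∉ B∩B'=∅ x∈B) (x∈∁p⇒x∉p (B⊆U x∈B)))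
      not-below : ¬ Below B B' S (∁ S)
      not-below (_ , _ , ∁S⊆B') = ⊆U⇒∌i B'⊆U (∁S⊆B' (x∉p⇒x∈∁p (⊆U⇒∌i S⊆U)))

module ShapleyMobius {n : ℕ} (v m : Subset n → Subset n → ℚ) (mobius : IsMobius v m)
                     (i : Fin n) where
  open MobiusExpansion v m mobius using (mobius-difference)
  open Player i

  weight : Subset n → ℚ
  weight S = [ ¬? (i ∈? S) ]⇒ shapleyCoeff n ∣ S ∣

  module _ (X₁ X₂ Y₁ Y₂ : Subset n → Subset n)
           (X-disjoint : ∀ S → Disjoint (X₁ S) (X₂ S)) (Y-disjoint : ∀ S → Disjoint (Y₁ S) (Y₂ S))
           (Y⇒X : ∀ B B' S → Below B B' (Y₁ S) (Y₂ S) → Below B B' (X₁ S) (X₂ S))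
           (Cond : Subset n → Subset n → Set) (cond? : ∀ B B' → Dec (Cond B B'))
           (Cond⇒B'⊆U : ∀ {B B'} → Cond B B' → B' ⊆ U)
           (marginal : ∀ B B' S →
              ((Below B B' (X₁ S) (X₂ S) × ¬ Below B B' (Y₁ S) (Y₂ S)) × i ∉ S)
                ⇔ (Cond B B' × (rest B' ⊆ S × S ⊆ U)))
           where

    -- The coefficient of m(B,B') is 1/(n - |B'|) if Cond B B' holds, and 0 otherwise:
    -- it is the total Shapley weight of the interval rest B' ⊆ S ⊆ U.
    marginal-coefficient : ∀ B B' →
      ΣSub (λ S → weight S * (χ (below? B B' (X₁ S) (X₂ S)) - χ (below? B B' (Y₁ S) (Y₂ S))))
        ≡ [ cond? B B' ]⇒ recip (n ∸ ∣ B' ∣)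
    marginal-coefficient B B' = begin
      ΣSub (λ S → weight S * (χ (x? S) - χ (y? S)))
        ≡⟨ Σ-cong subsets (λ S → cong (weight S *_) (χ-difference (Y⇒X B B' S) (x? S) (y? S))) ⟩
      ΣSub (λ S → weight S * χ (x? S ×-dec ¬? (y? S)))
        ≡⟨ Σ-cong subsets (λ S → []⇒-*-χ (¬? (i ∈? S)) (x? S ×-dec ¬? (y? S)) (c S)) ⟩
      ΣSub (λ S → [ (x? S ×-dec ¬? (y? S)) ×-dec ¬? (i ∈? S) ]⇒ c S)
        ≡⟨ Σ-cong subsets (λ S → []⇒-⇔ (Equivalence.to (marginal B B' S))
                                       (Equivalence.from (marginal B B' S))
                                       ((x? S ×-dec ¬? (y? S)) ×-dec ¬? (i ∈? S))
                                       (cond? B B' ×-dec interval? S) (c S)) ⟩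
      ΣSub (λ S → [ cond? B B' ×-dec interval? S ]⇒ c S)
        ≡⟨ Σ-cong subsets (λ S → []⇒-× (cond? B B') (interval? S) (c S)) ⟩
      ΣSub (λ S → [ cond? B B' ]⇒ ([ interval? S ]⇒ c S))
        ≡⟨ Σ-[]⇒ subsets (cond? B B') (λ S → [ interval? S ]⇒ c S) ⟩
      [ cond? B B' ]⇒ ΣSub (λ S → [ interval? S ]⇒ c S)
        ≡⟨ []⇒-guard (cond? B B') (λ cond → shapley-interval B' (Cond⇒B'⊆U cond)) ⟩
      [ cond? B B' ]⇒ recip (n ∸ ∣ B' ∣) ∎
      where
      open ≡-Reasoning
      subsets : List (Subset n)
      subsets = allSubsets n
      c : Subset n → ℚ
      c S = shapleyCoeff n ∣ S ∣
      x? : ∀ S → Dec (Below B B' (X₁ S) (X₂ S))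
      x? S = below? B B' (X₁ S) (X₂ S)
      y? : ∀ S → Dec (Below B B' (Y₁ S) (Y₂ S))
      y? S = below? B B' (Y₁ S) (Y₂ S)
      interval? : ∀ S → Dec (rest B' ⊆ S × S ⊆ U)
      interval? S = rest B' ⊆? S ×-dec S ⊆? U

    shapley-formula :
      ΣSub (λ S → [ ¬? (i ∈? S) ]⇒ (shapleyCoeff n ∣ S ∣ * (v (X₁ S) (X₂ S) - v (Y₁ S) (Y₂ S))))
        ≡ ΣSub (λ B → ΣSub (λ B' → [ cond? B B' ]⇒ (recip (n ∸ ∣ B' ∣) * m B B')))
    shapley-formula = begin
      ΣSub (λ S → [ ¬? (i ∈? S) ]⇒ (shapleyCoeff n ∣ S ∣ * (v (X₁ S) (X₂ S) - v (Y₁ S) (Y₂ S))))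
        ≡⟨ Σ-cong subsets (λ S → []⇒-*ʳ (¬? (i ∈? S)) (shapleyCoeff n ∣ S ∣)
                                        (v (X₁ S) (X₂ S) - v (Y₁ S) (Y₂ S))) ⟩
      ΣSub (λ S → weight S * (v (X₁ S) (X₂ S) - v (Y₁ S) (Y₂ S)))
        ≡⟨ mobius-difference weight X₁ X₂ Y₁ Y₂ X-disjoint Y-disjoint ⟩
      ΣSub (λ B → ΣSub (λ B' →
        ΣSub (λ S → weight S * (χ (below? B B' (X₁ S) (X₂ S)) - χ (below? B B' (Y₁ S) (Y₂ S))))
          * m B B'))
        ≡⟨ Σ-cong subsets (λ B → Σ-cong subsets (λ B' →
             trans (cong (_* m B B') (marginal-coefficient B B'))
                   (sym ([]⇒-*ʳ (cond? B B') (recip (n ∸ ∣ B' ∣)) (m B B'))))) ⟩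
      ΣSub (λ B → ΣSub (λ B' → [ cond? B B' ]⇒ (recip (n ∸ ∣ B' ∣) * m B B'))) ∎
      where
      open ≡-Reasoning
      subsets : List (Subset n)
      subsets = allSubsets n

proposition4 : (n : ℕ) (v m : Subset n → Subset n → ℚ) →
    v ⊥ ⊥ ≡ 0ℚ → IsMobius v m → (i : Fin n) →
    (φ⁺ v i ≡ ΣSub (λ S → ΣSub (λ T →
        [ disjoint? S T ×-dec ((⁅ i ⁆ , ∁ ⁅ i ⁆) ⊑? (S , T)) ]⇒
          (recip (n ∸ ∣ T ∣) * m S T))))
    × (φ⁻ v i ≡ ΣSub (λ S → ΣSub (λ T →
        [ (disjoint? S T ×-dec (S ⊆? ∁ ⁅ i ⁆ ×-dec T ⊆? ∁ ⁅ i ⁆))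
            ×-dec ((⊥ , ∁ ⁅ i ⁆) ⊑? (S , T)) ]⇒
          (recip (n ∸ ∣ T ∣) * m S T))))
proposition4 n v m _ mobius i =
    shapley-formula (_∪ ⁅ i ⁆) (λ S → ∁ (S ∪ ⁅ i ⁆)) (λ S → S) (λ S → ∁ (S ∪ ⁅ i ⁆))
      (λ S → disjoint-∁ ⊆-refl) (λ S → disjoint-∁ (p⊆p∪q ⁅ i ⁆)) below-join
      _ (λ B B' → disjoint? B B' ×-dec ((⁅ i ⁆ , ∁ ⁅ i ⁆) ⊑? (B , B')))
      (λ (_ , _ , B'⊆U) → B'⊆U) marginal⁺
  , shapley-formula (λ S → S) (λ S → ∁ (S ∪ ⁅ i ⁆)) (λ S → S) ∁
      (λ S → disjoint-∁ (p⊆p∪q ⁅ i ⁆)) (λ S → disjoint-∁ ⊆-refl) below-leave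
      _ (λ B B' → (disjoint? B B' ×-dec (B ⊆? ∁ ⁅ i ⁆ ×-dec B' ⊆? ∁ ⁅ i ⁆))
                    ×-dec ((⊥ , ∁ ⁅ i ⁆) ⊑? (B , B')))
      (λ (_ , _ , B'⊆U) → B'⊆U) marginal⁻
  where
  open Player i
  open ShapleyMobius v m mobius i
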